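{- Let $x_1,\dots,x_n$ be the colexicographically sorted $k$-mers of the extended $k$-spectrum of a set of strings. Let $\alpha\in\Sigma^*$ and $c\in\Sigma$ be such that $\alpha c$ is a suffix of at least one $x_i$. If $[\ell,r]_{\alpha c}$ is an L-interval (i.e. the colexicographic interval $[\ell,r]$ of $\alpha c$ is an L-interval and $\alpha c$ is the shortest string with that interval), then, writing $[\ell',r']$ for the colexicographic interval of $\alpha$, $[\ell',r']_\alpha$ is an L-interval (i.e. $[\ell',r']$ is an L-interval and $\alpha$ is the shortest string whose colexicographic interval is $[\ell',r']$).
   Context: Strings $T_1,\dots,T_m$ are over an alphabet $\Sigma$; $\$\notin\Sigma$ is a special character smaller than every character of $\Sigma$. The colexicographic order of two strings is the lexicographic order of their reversals. The $k$-spectrum $S_k(T)$ of a string $T$ is the set of distinct length-$k$ substrings of $T$; for a set of strings it is the union. The $k$-prefix set of $T$ is $P_k(T)=\{\$^{k-i}T[1..i] : i=0,\dots,k-1\}$ (union over a set of strings). The $k$-source set of a set $K$ of $k$-mers is $R_k(K)=\{x\in K : \text{there is no } y\in K \text{ with } y[2..k]=x[1..k-1]\}$. The extended $k$-spectrum is $S'_k(T_1,\dots,T_m)=S_k(T_1,\dots,T_m)\cup P_k(R_k(S_k(T_1,\dots,T_m)))\cup\{\$^k\}$; let $n$ be its size and $x_i$ its colexicographically $i$-th element. For a string $\alpha$ that is a suffix of at least one $x_i$, its colexicographic interval $[\ell,r]_\alpha$ has $\ell$ and $r$ the colexicographic ranks of the smallest and largest $x_i$ having $\alpha$ as a suffix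 (the empty string has interval $[1,n]$). A colexicographic interval $[\ell,r]$ is an L-interval iff it is the longest (i.e. with smallest left endpoint) colexicographic interval among those of all strings whose interval has right endpoint $r$; the notation $[\ell,r]_\alpha$ for an L-interval means $\alpha$ is the shortest string whose colexicographic interval is $[\ell,r]$. -}

module Defs where

open import Data.Nat using (ℕ; zero; suc; _+_; _∸_; _<_; _≤_)
open import Data.Nat.Properties using (_≟_; <-cmp)
import Data.Nat.Properties as ℕP
open import Data.List using (List; []; _∷_; _++_; map; concatMap; take; drop; replicate; reverse; filter; length; deduplicate; upTo; [_])
open import Data.List.Properties using (≡-dec)
open import Data.List.Membership.Propositional using (_∈_)
open import Data.List.Relation.Unary.Any using (any?)
open import Data.List.Relation.Binary.Lex.Strict using (Lex-<; <-decidable)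
open import Data.Product using (Σ; ∃; _×_; _,_)
open import Relation.Binary.PropositionalEquality using (_≡_)
open import Relation.Nullary using (¬?)
open import Relation.Binary.Definitions using (Decidable)

-- Characters: ℕ.  The special character $ is 0; a letter a of the
-- alphabet Σ = ℕ (usual order) is encoded as suc a, so $ < every letter.
Str : Set
Str = List ℕ

dollar : ℕ
dollar = 0

lift : List ℕ → Str
lift = map suc

_≟s_ : Decidable {A = Str} _≡_
_≟s_ = ≡-dec _≟_

_<colex_ : Str → Str → Set
x <colex y = Lex-< _≡_ _<_ (reverse x) (reverse y)

_<colex?_ : Decidable _<colex_
x <colex? y = <-decidable _≟_ ℕP._<?_ (reverse x) (reverse y)

IsSuffix : Str → Str → Set
IsSuffix α x = ∃ λ p → p ++ α ≡ x

substrings : ℕ → Str → List Str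
substrings k T = map (λ i → take k (drop i T)) (upTo (suc (length T) ∸ k))

spectrum : ℕ → List Str → List Str
spectrum k Ts = deduplicate _≟s_ (concatMap (substrings k) Ts)

prefixSet : ℕ → Str → List Str
prefixSet k T = map (λ i → replicate (k ∸ i) dollar ++ take i T) (upTo k)

sourceSet : ℕ → List Str → List Str
sourceSet k K = filter (λ x → ¬? (any? (λ y → drop 1 y ≟s take (k ∸ 1) x) K)) K

extSpectrum : ℕ → List (List ℕ) → List Str
extSpectrum k Ts =
  let S = spectrum k (map lift Ts) in
  deduplicate _≟s_ (S ++ concatMap (prefixSet k) (sourceSet k S) ++ [ replicate k dollar ])

-- colexicographic rank (1-based) of x in K
rank : List Str → Str → ℕ
rank K x = suc (length (filter (λ y → y <colex? x) K))

ColexInterval : List Str → Str → ℕ → ℕ → Set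
ColexInterval K α ℓ r =
  (Σ Str λ x → x ∈ K × IsSuffix α x × rank K x ≡ ℓ
     × (∀ z → z ∈ K → IsSuffix α z → ℓ ≤ rank K z))
  × (Σ Str λ y → y ∈ K × IsSuffix α y × rank K y ≡ r
     × (∀ z → z ∈ K → IsSuffix α z → rank K z ≤ r))

-- [ℓ , r] is an L-interval: it is a colexicographic interval, and it is the
-- longest (smallest left endpoint) among the colexicographic intervals of
-- all strings whose interval has right endpoint r.
IsLInterval : List Str → ℕ → ℕ → Set
IsLInterval K ℓ r =
  (∃ λ β → ColexInterval K β ℓ r)
  × (∀ β ℓ₂ → ColexInterval K β ℓ₂ r → ℓ ≤ ℓ₂)

IsLIntervalOf : List Str → Str → ℕ → ℕ → Set
IsLIntervalOf K α ℓ r =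
  IsLInterval K ℓ r × ColexInterval K α ℓ r
  × (∀ β → ColexInterval K β ℓ r → length α ≤ length β)

-- Let Y be the last k-mer ending in α. A string β whose interval also ends at
-- Y is comparable with α as a suffix of Y, so it suffices to rule out that β
-- is a proper suffix of α. In that case βc ends where αc ends: a k-mer beyond
-- the last one ending in αc, but ending in βc, diverges from it inside αc, and
-- its predecessor (which the $-padding guarantees) lies beyond Y and ends in
-- β. Since [ℓ , r] is an L-interval, βc then also starts at ℓ, contradicting
-- that αc is the shortest string with interval [ℓ , r].

module Submission where

open import Defs
open import Data.Nat using (ℕ; zero; suc; _+_; _∸_; _<_; _≤_; _⊓_; s≤s; z≤n; _≤?_)
open import Data.Nat.Properties
  using ( _≟_; ≤-refl; ≤-reflexive; ≤-antisym; ≤-pred; <⇒≤; <⇒≱; ≰⇒>; <-irrefl; <-≤-trans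
        ; m≤n⇒m≤1+n; n<1+n; n≮0; +-comm; m≤n+m; +-cancelʳ-≤; +-∸-assoc; m+n∸n≡m; m∸n+n≡m
        ; m≤n⇒m⊓n≡m; m∸n≢0⇒n<m; m≤o∸n⇒m+n≤o; m+n≤o⇒m≤o∸n)
import Data.Nat.Properties as ℕ
open import Data.List using (List; []; _∷_; _++_; map; concatMap; take; drop; replicate; reverse; filter; length; [_]; _∷ʳ_)
open import Data.List.Properties
  using ( ++-assoc; ++-identityʳ; ++-cancelʳ; ∷-injectiveˡ; ∷-injectiveʳ; ∷ʳ-injectiveˡ; ∷ʳ-++; map-++
        ; length-++; length-take; length-drop; length-replicate; length-reverse
        ; reverse-++; unfold-reverse; reverse-involutive; reverse-injective; take++drop≡id)
open import Data.List.Membership.Propositional using (_∈_; find; lose)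
open import Data.List.Membership.Propositional.Properties
  using ( ∈-map⁺; ∈-map⁻; ∈-++⁺ˡ; ∈-++⁺ʳ; ∈-++⁻; ∈-concatMap⁺; ∈-concatMap⁻
        ; ∈-filter⁺; ∈-filter⁻; ∈-deduplicate⁺; ∈-deduplicate⁻; ∈-upTo⁺; ∈-upTo⁻)
open import Data.List.Relation.Unary.Any using (here; there; any?)
open import Data.List.Relation.Unary.All as All using ()
open import Data.List.Relation.Binary.Lex.Strict using (Lex-<; <-isStrictTotalOrder)
open import Data.List.Relation.Binary.Lex.Core using (this; next)
open import Data.List.Relation.Binary.Pointwise using (Pointwise-≡⇒≡; ≡⇒Pointwise-≡)
open import Data.List.Relation.Binary.Suffix.Heterogeneous.Properties using (suffix?)
open import Data.List.Relation.Binary.Suffix.Heterogeneous as Suffix using (Suffix)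
open import Data.List.Extrema.Nat using (argmin; argmin-all; f[argmin]≤f[xs])
open import Data.Product using (∃; ∃₂; _×_; _,_; proj₁; proj₂)
open import Data.Sum using (_⊎_; inj₁; inj₂)
open import Data.Empty using (⊥-elim)
open import Function using (_∘_)
open import Relation.Nullary using (¬_; yes; no)
open import Relation.Nullary.Decidable using (map′)
open import Relation.Binary.Definitions using (Decidable; Trichotomous; tri<; tri≈; tri>)
open import Relation.Binary.Structures using (IsStrictTotalOrder)
open import Relation.Binary.PropositionalEquality
  using (_≡_; refl; sym; trans; cong; cong₂; subst; subst₂; module ≡-Reasoning)
open import Relation.Unary as U using (_⊆_)

open ≡-Reasoning

isSuffix-trans : ∀ {s t x : Str} → IsSuffix s t → IsSuffix t x → IsSuffix s x
isSuffix-trans {s} (p , refl) (q , refl) = q ++ p , ++-assoc q p s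

isSuffix-∷⁻ : ∀ {a t x} → IsSuffix (a ∷ t) x → IsSuffix t x
isSuffix-∷⁻ {a} = isSuffix-trans ([ a ] , refl)

isSuffix-length : ∀ {s x : Str} → IsSuffix s x → length s ≤ length x
isSuffix-length {s} (p , refl) = subst (length s ≤_) (sym (length-++ p)) (m≤n+m (length s) (length p))

isSuffix-++ʳ : ∀ {s t : Str} u → IsSuffix s t → IsSuffix (s ++ u) (t ++ u)
isSuffix-++ʳ {s} u (p , refl) = p , sym (++-assoc p s u)

isSuffix-++ʳ⁻ : ∀ {s t : Str} u → IsSuffix (s ++ u) (t ++ u) → IsSuffix s t
isSuffix-++ʳ⁻ {s} {t} u (p , eq) = p , ++-cancelʳ u (p ++ s) t (trans (++-assoc p s u) eq)

isSuffix-++ʳ-split : ∀ {s t u : Str} → IsSuffix (s ++ u) t → ∃ λ t₀ → t ≡ t₀ ++ u × IsSuffix s t₀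
isSuffix-++ʳ-split {s} {u = u} (p , refl) = p ++ s , sym (++-assoc p s u) , (p , refl)

++-≡⇒isSuffix : ∀ p q {s t : Str} → p ++ s ≡ q ++ t → length s ≤ length t → IsSuffix s t
++-≡⇒isSuffix p       []      eq _  = p , eq
++-≡⇒isSuffix []      (_ ∷ q) refl le = ⊥-elim (<⇒≱ (s≤s (isSuffix-length (q , refl))) le)
++-≡⇒isSuffix (_ ∷ p) (_ ∷ q) eq le = ++-≡⇒isSuffix p q (∷-injectiveʳ eq) le

isSuffix-nested : ∀ {s t x : Str} → IsSuffix s x → IsSuffix t x → length s ≤ length t → IsSuffix s t
isSuffix-nested (p , p++s≡x) (q , q++t≡x) = ++-≡⇒isSuffix p q (trans p++s≡x (sym q++t≡x))

isSuffix-unique : ∀ {s t x : Str} → IsSuffix s x → IsSuffix t x → length s ≡ length t → s ≡ t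
isSuffix-unique s⊑x t⊑x eq with isSuffix-nested s⊑x t⊑x (≤-reflexive eq)
... | []    , s≡t  = s≡t
... | _ ∷ p , refl = ⊥-elim (<-irrefl eq (s≤s (isSuffix-length (p , refl))))

isSuffix? : Decidable IsSuffix
isSuffix? s x = map′ fromSuffix toSuffix (suffix? _≟_ s x)
  where
    fromSuffix : Suffix _≡_ s x → IsSuffix s x
    fromSuffix suf with p Suffix.++ s≋ ← Suffix.toView suf = p , cong (p ++_) (Pointwise-≡⇒≡ s≋)
    toSuffix : IsSuffix s x → Suffix _≡_ s x
    toSuffix (p , refl) = Suffix.fromView (p Suffix.++ ≡⇒Pointwise-≡ refl)

private
  module LexOrder = IsStrictTotalOrder (<-isStrictTotalOrder {_≈_ = _≡_} {_≺_ = _<_} ℕ.<-isStrictTotalOrder)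

<colex-trans : ∀ {x y z} → x <colex y → y <colex z → x <colex z
<colex-trans = LexOrder.trans

<colex-irrefl : ∀ {x} → ¬ x <colex x
<colex-irrefl = LexOrder.irrefl (≡⇒Pointwise-≡ refl)

<colex-cmp : Trichotomous _≡_ _<colex_
<colex-cmp x z with LexOrder.compare (reverse x) (reverse z)
... | tri< lt ¬eq ¬gt = tri< lt (¬eq ∘ ≡⇒Pointwise-≡ ∘ cong reverse) ¬gt
... | tri≈ ¬lt eq ¬gt = tri≈ ¬lt (reverse-injective (Pointwise-≡⇒≡ eq)) ¬gt
... | tri> ¬lt ¬eq gt = tri> ¬lt (¬eq ∘ ≡⇒Pointwise-≡ ∘ cong reverse) gt

-- Two equal-length strings are colex-ordered exactly when, reading from the
-- right, they agree on a common tail t and then differ by a letter a < b.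
data ColexSplit (t : Str) (x z : Str) : Set where
  split : ∀ {a b} → a < b → IsSuffix (a ∷ t) x → IsSuffix (b ∷ t) z → ColexSplit t x z

reverse-++-∷ : ∀ (u : Str) a t → reverse (u ++ a ∷ t) ≡ reverse t ++ a ∷ reverse u
reverse-++-∷ u a t = begin
  reverse (u ++ a ∷ t)          ≡⟨ reverse-++ u (a ∷ t) ⟩
  reverse (a ∷ t) ++ reverse u  ≡⟨ cong (_++ reverse u) (unfold-reverse a t) ⟩
  (reverse t ∷ʳ a) ++ reverse u ≡⟨ ∷ʳ-++ (reverse t) a (reverse u) ⟩
  reverse t ++ a ∷ reverse u    ∎

lex-++-∷ : ∀ (w : Str) {a b xs ys} → a < b → Lex-< _≡_ _<_ (w ++ a ∷ xs) (w ++ b ∷ ys)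
lex-++-∷ []      a<b = this a<b
lex-++-∷ (_ ∷ w) a<b = next refl (lex-++-∷ w a<b)

lex-split : ∀ {xs ys : Str} → Lex-< _≡_ _<_ xs ys → length xs ≡ length ys →
  ∃ λ w → ∃₂ λ a b → a < b × (∃ λ xs′ → xs ≡ w ++ a ∷ xs′) × (∃ λ ys′ → ys ≡ w ++ b ∷ ys′)
lex-split (this {x} {xs} {y} {ys} a<b) _ = [] , x , y , a<b , (xs , refl) , (ys , refl)
lex-split (next {x} refl rest) eq with lex-split rest (ℕ.suc-injective eq)
... | w , a , b , a<b , (xs′ , refl) , (ys′ , refl) = x ∷ w , a , b , a<b , (xs′ , refl) , (ys′ , refl)

split⇒<colex : ∀ {t x z} → ColexSplit t x z → x <colex z
split⇒<colex {t} (split {a} {b} a<b (p , refl) (q , refl)) =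
  subst₂ (Lex-< _≡_ _<_) (sym (reverse-++-∷ p a t)) (sym (reverse-++-∷ q b t)) (lex-++-∷ (reverse t) a<b)

<colex⇒split : ∀ {x z} → length x ≡ length z → x <colex z → ∃ λ t → ColexSplit t x z
<colex⇒split {x} {z} eq x<z
  with w , a , b , a<b , (xs′ , rx≡) , (ys′ , rz≡)
         ← lex-split x<z (trans (length-reverse x) (trans eq (sym (length-reverse z))))
  = reverse w , split a<b (reverse xs′ , unreverse x rx≡) (reverse ys′ , unreverse z rz≡)
  where
    unreverse : ∀ y {c u v} → reverse y ≡ u ++ c ∷ v → reverse v ++ c ∷ reverse u ≡ y
    unreverse y {c} {u} {v} e =
      trans (sym (reverse-++-∷ u c v)) (trans (cong reverse (sym e)) (reverse-involutive y))

split-commonSuffix : ∀ {t x z s} → ColexSplit t x z → IsSuffix s x → IsSuffix s z → IsSuffix s t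
split-commonSuffix {t} {s = s} (split a<b at⊑x bt⊑z) s⊑x s⊑z with length s ≤? length t
... | yes s≤t = isSuffix-nested s⊑x (isSuffix-∷⁻ at⊑x) s≤t
... | no  s≰t = ⊥-elim (<-irrefl (∷-injectiveˡ at≡bt) a<b)
  where
    at≡bt = isSuffix-unique (isSuffix-trans (isSuffix-nested at⊑x s⊑x (≰⇒> s≰t)) s⊑z) bt⊑z refl

module _ {P Q : Str → Set} (P? : U.Decidable P) (Q? : U.Decidable Q) (P⊆Q : P ⊆ Q) where

  length-filter-mono : ∀ xs → length (filter P? xs) ≤ length (filter Q? xs)
  length-filter-mono [] = z≤n
  length-filter-mono (y ∷ xs) with P? y | Q? y
  ... | yes _  | yes _  = s≤s (length-filter-mono xs)
  ... | yes py | no ¬qy = ⊥-elim (¬qy (P⊆Q py))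
  ... | no _   | yes _  = m≤n⇒m≤1+n (length-filter-mono xs)
  ... | no _   | no _   = length-filter-mono xs

  length-filter-mono-< : ∀ {x xs} → x ∈ xs → Q x → ¬ P x → length (filter P? xs) < length (filter Q? xs)
  length-filter-mono-< {xs = y ∷ xs} (here refl) qx ¬px with P? y | Q? y
  ... | yes px | _      = ⊥-elim (¬px px)
  ... | no _   | yes _  = s≤s (length-filter-mono xs)
  ... | no _   | no ¬qx = ⊥-elim (¬qx qx)
  length-filter-mono-< {xs = y ∷ xs} (there x∈) qx ¬px with P? y | Q? y
  ... | yes _  | yes _  = s≤s (length-filter-mono-< x∈ qx ¬px)
  ... | yes py | no ¬qy = ⊥-elim (¬qy (P⊆Q py))
  ... | no _   | yes _  = m≤n⇒m≤1+n (length-filter-mono-< x∈ qx ¬px)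
  ... | no _   | no _   = length-filter-mono-< x∈ qx ¬px

rank-mono-< : ∀ {K x z} → x ∈ K → x <colex z → rank K x < rank K z
rank-mono-< {x = x} {z} x∈ x<z =
  s≤s (length-filter-mono-< (_<colex? x) (_<colex? z) (λ {y} y<x → <colex-trans {y} {x} {z} y<x x<z)
                            x∈ x<z (<colex-irrefl {x}))

rank-injective : ∀ {K x z} → x ∈ K → z ∈ K → rank K x ≡ rank K z → x ≡ z
rank-injective {x = x} {z} x∈ z∈ eq with <colex-cmp x z
... | tri< x<z _ _ = ⊥-elim (<-irrefl eq (rank-mono-< {z = z} x∈ x<z))
... | tri≈ _ x≡z _ = x≡z
... | tri> _ _ z<x = ⊥-elim (<-irrefl (sym eq) (rank-mono-< {z = x} z∈ z<x))

-- Colexicographic intervals in an arbitrary set of strings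

module _ {K : List Str} where

  colexInterval-withMax : ∀ {α x} → x ∈ K → IsSuffix α x →
    (∀ z → z ∈ K → IsSuffix α z → rank K z ≤ rank K x) → ∃ λ ℓ → ColexInterval K α ℓ (rank K x)
  colexInterval-withMax {α} {x} x∈ α⊑x greatest =
    rank K y , (y , y∈ , α⊑y , refl , least) , (x , x∈ , α⊑x , refl , greatest)
    where
      candidates = filter (isSuffix? α) K
      y = argmin (rank K) x candidates
      y∈α⊑y : y ∈ K × IsSuffix α y
      y∈α⊑y = argmin-all (rank K) (x∈ , α⊑x) (All.tabulate (∈-filter⁻ (isSuffix? α)))
      y∈ = proj₁ y∈α⊑y
      α⊑y = proj₂ y∈α⊑y
      least : ∀ z → z ∈ K → IsSuffix α z → rank K y ≤ rank K z
      least z z∈ α⊑z = All.lookup (f[argmin]≤f[xs] x candidates) (∈-filter⁺ (isSuffix? α) z∈ α⊑z)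

  isSuffix⇒leftEnd-≤ : ∀ {α β ℓ r ℓ₂ r₂} → IsSuffix β α →
    ColexInterval K α ℓ r → ColexInterval K β ℓ₂ r₂ → ℓ₂ ≤ ℓ
  isSuffix⇒leftEnd-≤ β⊑α ((x , x∈ , α⊑x , refl , _) , _) ((_ , _ , _ , _ , least) , _) =
    least x x∈ (isSuffix-trans β⊑α α⊑x)

  -- Both strings are suffixes of the unique element of rank r.
  sameRightEnd⇒isSuffix : ∀ {α β ℓ₁ ℓ₂ r} → ColexInterval K α ℓ₁ r → ColexInterval K β ℓ₂ r →
    length α ≤ length β → IsSuffix α β
  sameRightEnd⇒isSuffix (_ , (y , y∈ , α⊑y , refl , _)) (_ , (y′ , y′∈ , β⊑y′ , ry′ , _))
    with refl ← rank-injective y∈ y′∈ (sym ry′) = isSuffix-nested α⊑y β⊑y′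

-- Left extension of k-mers, the property of the extended spectrum that the
-- $-padding provides.

HasPredecessors : List Str → Set
HasPredecessors K = ∀ {v e} → v ++ [ e ] ∈ K → ∃ λ w → w ∈ K × IsSuffix v w

module _ {K : List Str} {k : ℕ} (K-length : ∀ {x} → x ∈ K → length x ≡ k) (K-pred : HasPredecessors K) where

  predecessor-++ʳ : ∀ {s c z} → z ∈ K → IsSuffix (s ++ [ c ]) z → ∃ λ w → w ∈ K × IsSuffix s w
  predecessor-++ʳ {s} {c} z∈ (p , refl) with w , w∈ , ps⊑w ← K-pred (subst (_∈ K) (sym (++-assoc p s [ c ])) z∈)
    = w , w∈ , isSuffix-trans (p , refl) ps⊑w

  -- If β ⊑ α ends where α does, then βc ends where αc does: an element z ⊒ βc
  -- beyond the last element X ⊒ αc splits from X inside αc, and the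
  -- predecessor of z then lies beyond the last element ⊒ α while ending in β.
  rightEnd-++ʳ : ∀ {α β c ℓ r ℓ′ r′ ℓ₂} → IsSuffix β α →
    ColexInterval K (α ++ [ c ]) ℓ r → ColexInterval K α ℓ′ r′ → ColexInterval K β ℓ₂ r′ →
    ∀ z → z ∈ K → IsSuffix (β ++ [ c ]) z → rank K z ≤ r
  rightEnd-++ʳ {α} {β} {c} β⊑α (_ , (X , X∈ , αc⊑X , refl , αc-max)) (_ , (Y , Y∈ , α⊑Y , refl , _))
               (_ , (_ , _ , _ , _ , β-max)) z z∈ βc⊑z
    with <colex-cmp z X
  ... | tri< z<X _ _ = <⇒≤ (rank-mono-< {z = X} z∈ z<X)
  ... | tri≈ _ refl _ = ≤-refl
  ... | tri> _ _ X<z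
    with t , sp@(split {a} {b} a<b at⊑X bt⊑z) ← <colex⇒split (trans (K-length X∈) (sym (K-length z∈))) X<z
    with t₀ , refl , β⊑t₀ ← isSuffix-++ʳ-split {u = [ c ]}
                              (split-commonSuffix sp (isSuffix-trans (isSuffix-++ʳ [ c ] β⊑α) αc⊑X) βc⊑z)
    with length (α ++ [ c ]) ≤? length (t₀ ++ [ c ])
  ... | yes αc≤t =
    αc-max z z∈ (isSuffix-trans (isSuffix-nested αc⊑X (isSuffix-∷⁻ at⊑X) αc≤t) (isSuffix-∷⁻ bt⊑z))
  ... | no  αc≰t
    with w , w∈ , bt₀⊑w ← predecessor-++ʳ {s = b ∷ t₀} z∈ bt⊑z
    = ⊥-elim (<-irrefl refl (<-≤-trans (rank-mono-< {z = w} Y∈ Y<w) (β-max w w∈ β⊑w)))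
    where
      at₀⊑α : IsSuffix (a ∷ t₀) α
      at₀⊑α = isSuffix-++ʳ⁻ [ c ] (isSuffix-nested at⊑X αc⊑X (≰⇒> αc≰t))
      Y<w : Y <colex w
      Y<w = split⇒<colex (split a<b (isSuffix-trans at₀⊑α α⊑Y) bt₀⊑w)
      β⊑w : IsSuffix β w
      β⊑w = isSuffix-trans β⊑t₀ (isSuffix-∷⁻ bt₀⊑w)

  -- Otherwise βc would have the interval [ℓ , r] of αc while being shorter.
  sameRightEnd-isSuffix⇒length-≥ : ∀ {α β c ℓ r ℓ′ r′ ℓ₂} → IsLIntervalOf K (α ++ [ c ]) ℓ r →
    ColexInterval K α ℓ′ r′ → IsSuffix β α → ColexInterval K β ℓ₂ r′ → length α ≤ length β
  sameRightEnd-isSuffix⇒length-≥ {α} {β} {c}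
    ((_ , L-longest) , αcI@(_ , (X , X∈ , αc⊑X , refl , _)) , αc-shortest) αI β⊑α βI
    with ℓ₃ , βcI ← colexInterval-withMax X∈ (isSuffix-trans (isSuffix-++ʳ [ c ] β⊑α) αc⊑X)
                                            (rightEnd-++ʳ β⊑α αcI αI βI)
    = +-cancelʳ-≤ 1 (length α) (length β) (subst₂ _≤_ (length-++ α) (length-++ β)
        (αc-shortest (β ++ [ c ]) (subst (λ ℓ → ColexInterval K (β ++ [ c ]) ℓ _) ℓ₃≡ℓ βcI)))
    where
      βc⊑αc = isSuffix-++ʳ [ c ] β⊑α
      ℓ₃≡ℓ = ≤-antisym (isSuffix⇒leftEnd-≤ βc⊑αc αcI βcI) (L-longest (β ++ [ c ]) ℓ₃ βcI)

  sameRightEnd⇒hasSuffix : ∀ {α β c ℓ r ℓ′ r′ ℓ₂} → IsLIntervalOf K (α ++ [ c ]) ℓ r →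
    ColexInterval K α ℓ′ r′ → ColexInterval K β ℓ₂ r′ → IsSuffix α β
  sameRightEnd⇒hasSuffix {α} {β} L αI βI with length α ≤? length β
  ... | yes α≤β = sameRightEnd⇒isSuffix αI βI α≤β
  ... | no  α≰β = ⊥-elim (α≰β (sameRightEnd-isSuffix⇒length-≥ L αI β⊑α βI))
    where β⊑α = sameRightEnd⇒isSuffix βI αI (<⇒≤ (≰⇒> α≰β))

  isLIntervalOf-init : ∀ {α c ℓ r ℓ′ r′} → IsLIntervalOf K (α ++ [ c ]) ℓ r →
    ColexInterval K α ℓ′ r′ → IsLIntervalOf K α ℓ′ r′
  isLIntervalOf-init {α} {ℓ′ = ℓ′} {r′} L αI = ((α , αI) , longest) , αI , shortest
    where
      longest : ∀ β ℓ₂ → ColexInterval K β ℓ₂ r′ → ℓ′ ≤ ℓ₂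
      longest β ℓ₂ βI = isSuffix⇒leftEnd-≤ (sameRightEnd⇒hasSuffix L αI βI) βI αI
      shortest : ∀ β → ColexInterval K β ℓ′ r′ → length α ≤ length β
      shortest β βI = isSuffix-length (sameRightEnd⇒hasSuffix L αI βI)

-- The extended k-spectrum

window-fits : ∀ {i k n} → i < suc n ∸ k → k ≤ n ∸ i
window-fits {i} {k} {n} i< =
  m+n≤o⇒m≤o∸n k (subst (_≤ n) (+-comm i k) (≤-pred (m≤o∸n⇒m+n≤o (suc i) k≤1+n i<)))
  where
    k≤1+n : k ≤ suc n
    k≤1+n = <⇒≤ (m∸n≢0⇒n<m (λ eq → n≮0 (subst (i <_) eq i<)))

substrings-length : ∀ k T {x} → x ∈ substrings k T → length x ≡ k
substrings-length k T x∈ with i , i∈ , refl ← ∈-map⁻ _ x∈ = begin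
  length (take k (drop i T)) ≡⟨ length-take k (drop i T) ⟩
  k ⊓ length (drop i T)      ≡⟨ cong (k ⊓_) (length-drop i T) ⟩
  k ⊓ (length T ∸ i)         ≡⟨ m≤n⇒m⊓n≡m (window-fits (∈-upTo⁻ i∈)) ⟩
  k                          ∎

spectrum-length : ∀ k Ts {x} → x ∈ spectrum k Ts → length x ≡ k
spectrum-length k Ts x∈
  with T , _ , x∈T ← find (∈-concatMap⁻ (substrings k) {xs = Ts} (∈-deduplicate⁻ _≟s_ _ x∈))
  = substrings-length k T x∈T

∈-prefixSet⁺ : ∀ {k i} T → i < k → replicate (k ∸ i) dollar ++ take i T ∈ prefixSet k T
∈-prefixSet⁺ {k} T i<k = ∈-map⁺ (λ i → replicate (k ∸ i) dollar ++ take i T) (∈-upTo⁺ i<k)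

∈-prefixSet⁻ : ∀ {k T x} → x ∈ prefixSet k T → ∃ λ i → i < k × x ≡ replicate (k ∸ i) dollar ++ take i T
∈-prefixSet⁻ x∈ with i , i∈ , x≡ ← ∈-map⁻ _ x∈ = i , ∈-upTo⁻ i∈ , x≡

prefixSet-length : ∀ {k T x} → length T ≡ k → x ∈ prefixSet k T → length x ≡ k
prefixSet-length {k} {T} |T|≡k x∈ with i , i<k , refl ← ∈-prefixSet⁻ x∈ = begin
  length (replicate (k ∸ i) dollar ++ take i T)          ≡⟨ length-++ (replicate (k ∸ i) dollar) ⟩
  length (replicate (k ∸ i) dollar) + length (take i T) ≡⟨ cong₂ _+_ (length-replicate (k ∸ i)) (length-take i T) ⟩
  k ∸ i + i ⊓ length T                                   ≡⟨ cong (λ n → k ∸ i + i ⊓ n) |T|≡k ⟩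
  k ∸ i + i ⊓ k                                          ≡⟨ cong (k ∸ i +_) (m≤n⇒m⊓n≡m (<⇒≤ i<k)) ⟩
  k ∸ i + i                                              ≡⟨ m∸n+n≡m (<⇒≤ i<k) ⟩
  k                                                      ∎

take-length-++ : ∀ (v w : Str) → take (length v) (v ++ w) ≡ v
take-length-++ []      w = refl
take-length-++ (x ∷ v) w = cong (x ∷_) (take-length-++ v w)

take-suc-∷ʳ : ∀ j (T : Str) → j < length T → ∃ λ e → take (suc j) T ≡ take j T ++ [ e ]
take-suc-∷ʳ zero    (t ∷ T) _       = t , refl
take-suc-∷ʳ (suc j) (t ∷ T) (s≤s j<) with e , eq ← take-suc-∷ʳ j T j< = e , cong (t ∷_) eq

-- For padded prefixes and for sources, the predecessor of v e is dollar ∷ v.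
dollar∷init≡replicate : ∀ {v e} n → v ++ [ e ] ≡ replicate n dollar → dollar ∷ v ≡ replicate n dollar
dollar∷init≡replicate {[]}    (suc zero)    refl = refl
dollar∷init≡replicate {[]}    (suc (suc n)) ()
dollar∷init≡replicate {_ ∷ v} (suc n) eq with refl ← ∷-injectiveˡ eq =
  cong (dollar ∷_) (dollar∷init≡replicate n (∷-injectiveʳ eq))

dollar∷init∈prefixSet : ∀ {k T v e} → length T ≡ k → v ++ [ e ] ∈ prefixSet k T →
  dollar ∷ v ∈ prefixSet k T ⊎ dollar ∷ v ≡ replicate k dollar
dollar∷init∈prefixSet {k} {T} {v} {e} |T|≡k x∈ with ∈-prefixSet⁻ x∈
... | zero  , _   , x≡ = inj₂ (dollar∷init≡replicate k (trans x≡ (++-identityʳ _)))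
... | suc j , 1+j<k , x≡ = inj₁ (subst (_∈ prefixSet k T) (sym dollar∷v≡) (∈-prefixSet⁺ T j<k))
  where
    j<k = <⇒≤ 1+j<k
    R = replicate (k ∸ suc j) dollar
    Tⱼ = take-suc-∷ʳ j T (subst (j <_) (sym |T|≡k) j<k)
    v≡ : v ≡ R ++ take j T
    v≡ = ∷ʳ-injectiveˡ v (R ++ take j T) (begin
      v ++ [ e ]                      ≡⟨ x≡ ⟩
      R ++ take (suc j) T             ≡⟨ cong (R ++_) (proj₂ Tⱼ) ⟩
      R ++ take j T ++ [ proj₁ Tⱼ ]   ≡⟨ ++-assoc R (take j T) _ ⟨
      (R ++ take j T) ++ [ proj₁ Tⱼ ] ∎)
    dollar∷v≡ : dollar ∷ v ≡ replicate (k ∸ j) dollar ++ take j T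
    dollar∷v≡ =
      trans (cong (dollar ∷_) v≡) (cong (λ n → replicate n dollar ++ take j T) (sym (+-∸-assoc 1 j<k)))

dollar∷init∈prefixSet-self : ∀ {k v e} → suc (length v) ≡ k → dollar ∷ v ∈ prefixSet k (v ++ [ e ])
dollar∷init∈prefixSet-self {v = v} {e} refl =
  subst (_∈ prefixSet (suc (length v)) (v ++ [ e ]))
        (cong₂ (λ n u → replicate n dollar ++ u) (m+n∸n≡m 1 (length v)) (take-length-++ v [ e ]))
        (∈-prefixSet⁺ (v ++ [ e ]) (n<1+n (length v)))

module _ (k : ℕ) (Ts : List (List ℕ)) where

  private
    S = spectrum k (map lift Ts)
    Srcs = sourceSet k S
    Prefixes = concatMap (prefixSet k) Srcs

    ∈-extSpectrum⁻ : ∀ {x} → x ∈ extSpectrum k Ts →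
      x ∈ S ⊎ (∃ λ T → T ∈ Srcs × x ∈ prefixSet k T) ⊎ x ≡ replicate k dollar
    ∈-extSpectrum⁻ x∈ with ∈-++⁻ S (∈-deduplicate⁻ _≟s_ _ x∈)
    ... | inj₁ x∈S = inj₁ x∈S
    ... | inj₂ x∈rest with ∈-++⁻ Prefixes x∈rest
    ...   | inj₁ x∈P = inj₂ (inj₁ (find (∈-concatMap⁻ (prefixSet k) {xs = Srcs} x∈P)))
    ...   | inj₂ (here x≡) = inj₂ (inj₂ x≡)

    S⊆extSpectrum : ∀ {x} → x ∈ S → x ∈ extSpectrum k Ts
    S⊆extSpectrum x∈ = ∈-deduplicate⁺ _≟s_ (∈-++⁺ˡ x∈)

    prefixSet⊆extSpectrum : ∀ {x T} → T ∈ Srcs → x ∈ prefixSet k T → x ∈ extSpectrum k Ts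
    prefixSet⊆extSpectrum T∈ x∈ =
      ∈-deduplicate⁺ _≟s_ (∈-++⁺ʳ S (∈-++⁺ˡ (∈-concatMap⁺ (prefixSet k) (lose T∈ x∈))))

    replicate∈extSpectrum : ∀ {x} → x ≡ replicate k dollar → x ∈ extSpectrum k Ts
    replicate∈extSpectrum refl = ∈-deduplicate⁺ _≟s_ (∈-++⁺ʳ S (∈-++⁺ʳ Prefixes (here refl)))

    viaDollar : ∀ {v} → dollar ∷ v ∈ extSpectrum k Ts → ∃ λ w → w ∈ extSpectrum k Ts × IsSuffix v w
    viaDollar w∈ = _ , w∈ , [ dollar ] , refl

    source-length : ∀ {T} → T ∈ Srcs → length T ≡ k
    source-length T∈ = spectrum-length k (map lift Ts) (proj₁ (∈-filter⁻ _ T∈))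

  extSpectrum-length : ∀ {x} → x ∈ extSpectrum k Ts → length x ≡ k
  extSpectrum-length x∈ with ∈-extSpectrum⁻ x∈
  ... | inj₁ x∈S                   = spectrum-length k (map lift Ts) x∈S
  ... | inj₂ (inj₁ (T , T∈ , x∈P)) = prefixSet-length (source-length T∈) x∈P
  ... | inj₂ (inj₂ refl)           = length-replicate k

  init-length : ∀ {v e} → v ++ [ e ] ∈ extSpectrum k Ts → suc (length v) ≡ k
  init-length {v} x∈ = trans (trans (+-comm 1 (length v)) (sym (length-++ v))) (extSpectrum-length x∈)

  extSpectrum-hasPredecessors : HasPredecessors (extSpectrum k Ts)
  extSpectrum-hasPredecessors {v} {e} x∈ with ∈-extSpectrum⁻ x∈
  ... | inj₂ (inj₂ x≡) = viaDollar (replicate∈extSpectrum (dollar∷init≡replicate k x≡))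
  ... | inj₂ (inj₁ (T , T∈ , x∈P)) with dollar∷init∈prefixSet (source-length T∈) x∈P
  ...   | inj₁ w∈ = viaDollar (prefixSet⊆extSpectrum T∈ w∈)
  ...   | inj₂ w≡ = viaDollar (replicate∈extSpectrum w≡)
  extSpectrum-hasPredecessors {v} {e} x∈ | inj₁ x∈S
    with any? (λ y → drop 1 y ≟s take (k ∸ 1) (v ++ [ e ])) S
  ... | no none =
    viaDollar (prefixSet⊆extSpectrum (∈-filter⁺ _ x∈S none) (dollar∷init∈prefixSet-self (init-length x∈)))
  ... | yes found with y , y∈ , drop1y≡ ← find found = y , S⊆extSpectrum y∈ , take 1 y , (begin
    take 1 y ++ v           ≡⟨ cong (take 1 y ++_) (trans drop1y≡ init≡v) ⟨
    take 1 y ++ drop 1 y    ≡⟨ take++drop≡id 1 y ⟩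
    y                       ∎)
    where
      init≡v : take (k ∸ 1) (v ++ [ e ]) ≡ v
      init≡v = subst (λ n → take (n ∸ 1) (v ++ [ e ]) ≡ v) (init-length x∈) (take-length-++ v [ e ])

lemma2 : (k : ℕ) (Ts : List (List ℕ)) (α : List ℕ) (c : ℕ) (ℓ r ℓ' r' : ℕ)
    → (∃ λ x → x ∈ extSpectrum k Ts × IsSuffix (lift (α ++ [ c ])) x)
    → IsLIntervalOf (extSpectrum k Ts) (lift (α ++ [ c ])) ℓ r
    → ColexInterval (extSpectrum k Ts) (lift α) ℓ' r'
    → IsLIntervalOf (extSpectrum k Ts) (lift α) ℓ' r'
lemma2 k Ts α c ℓ r ℓ' r' _ αc-L αI =
  isLIntervalOf-init (extSpectrum-length k Ts) (extSpectrum-hasPredecessors k Ts)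
    (subst (λ γ → IsLIntervalOf (extSpectrum k Ts) γ ℓ r) (map-++ suc α [ c ]) αc-L) αI
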